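{- Let $n,k \in \mathbb{N}$. If $n \leqslant 3k - 3$ then $m(n,3,2,k) = 0$. If $n \geqslant 3k - 2$ then $m(n,3,2,k) \leqslant n - k + 1$.
   Context: An $r$-colouring of the complete graph $K_n$ ($n \geqslant 2$) is any function $f: E(K_n) \to [r] = \{1,\dots,r\}$. For a subgraph $H \subseteq K_n$, $c_f(H) = |f(E(H))|$ is the number of distinct colours on edges of $H$. A graph on at least $k+1$ vertices is $k$-connected if deleting any at most $k-1$ vertices leaves a connected graph. $M(f,n,r,s,k)$ is the maximum number of vertices of a $k$-connected subgraph $H \subseteq K_n$ with $c_f(H) \leqslant s$ (taken to be $0$ if no such subgraph exists), and $m(n,r,s,k) = \min_f M(f,n,r,s,k)$, the minimum over all $r$-colourings $f$ of $E(K_n)$. -}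

module Defs where

open import Data.Nat as ℕ using (ℕ; zero; suc; _+_; _*_)
open import Data.Bool using (Bool; true; false; _∧_; _∨_)
open import Data.Fin using (Fin; _<_)
import Data.Fin as F
open import Data.Fin.Properties using (_≟_; _<?_)
open import Data.Fin.Subset using (Subset; _∈_; _∉_; _⊆_; ∣_∣)
open import Data.Vec using (tabulate)
open import Data.Product using (Σ; Σ-syntax; _×_; _,_; proj₁; proj₂)
open import Data.Sum using (_⊎_)
open import Data.Empty using (⊥)
open import Relation.Nullary using (¬_; yes; no)
open import Relation.Nullary.Decidable using (⌊_⌋)
open import Relation.Binary.PropositionalEquality using (_≡_)

-- Edges of K_n: pairs (i , j) of vertices with i < j (each unordered pair once).
Edge : ℕ → Set
Edge n = Σ (Fin n × Fin n) (λ p → proj₁ p < proj₂ p)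

Colouring : ℕ → ℕ → Set
Colouring n r = Edge n → Fin r

record Subgraph (n : ℕ) : Set where
  field
    V      : Subset n
    E      : Edge n → Bool
    closed : (e : Edge n) → E e ≡ true →
             (proj₁ (proj₁ e) ∈ V) × (proj₂ (proj₁ e) ∈ V)
open Subgraph public

∣V∣ : {n : ℕ} → Subgraph n → ℕ
∣V∣ H = ∣ V H ∣

anyFin : {n : ℕ} → (Fin n → Bool) → Bool
anyFin {zero}  p = false
anyFin {suc n} p = p F.zero ∨ anyFin (λ i → p (F.suc i))


usedAt : {n r : ℕ} → Colouring n r → Subgraph n → Fin r → Fin n → Fin n → Bool
usedAt f H c i j with i <? j
... | yes p = E H ((i , j) , p) ∧ ⌊ f ((i , j) , p) ≟ c ⌋
... | no _  = false

usedColours : {n r : ℕ} → Colouring n r → Subgraph n → Subset r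
usedColours f H = tabulate (λ c → anyFin (λ i → anyFin (λ j → usedAt f H c i j)))

c[_] : {n r : ℕ} → Colouring n r → Subgraph n → ℕ
c[ f ] H = ∣ usedColours f H ∣

Adj : {n : ℕ} → Subgraph n → Fin n → Fin n → Set
Adj H u v = (Σ[ p ∈ u < v ] E H ((u , v) , p) ≡ true)
          ⊎ (Σ[ p ∈ v < u ] E H ((v , u) , p) ≡ true)

data Reach {n : ℕ} (H : Subgraph n) (W : Fin n → Set) : Fin n → Fin n → Set where
  here : ∀ {u} → W u → Reach H W u u
  step : ∀ {u v w} → Reach H W u v → Adj H v w → W w → Reach H W u w

ConnectedMinus : {n : ℕ} → Subgraph n → Subset n → Set
ConnectedMinus H S = ∀ u v → u ∈ V H → u ∉ S → v ∈ V H → v ∉ S →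
                     Reach H (λ x → (x ∈ V H) × (x ∉ S)) u v

KConnected : {n : ℕ} → ℕ → Subgraph n → Set
KConnected k H = (k + 1 ℕ.≤ ∣V∣ H) ×
                 (∀ (S : Subset _) → S ⊆ V H → ∣ S ∣ ℕ.< k → ConnectedMinus H S)

Good : {n r : ℕ} → Colouring n r → ℕ → ℕ → Subgraph n → Set
Good f s k H = KConnected k H × (c[ f ] H ℕ.≤ s)

-- IsM f s k v : v = M(f,n,r,s,k), the maximum number of vertices of a
-- k-connected subgraph H with c_f(H) ≤ s, or 0 if there is none
IsM : {n r : ℕ} → Colouring n r → ℕ → ℕ → ℕ → Set
IsM {n} f s k v =
  ((H : Subgraph n) → Good f s k H → ∣V∣ H ℕ.≤ v) ×
  ((v ≡ 0 × ((H : Subgraph n) → ¬ Good f s k H)) ⊎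
   (Σ[ H ∈ Subgraph n ] Good f s k H × (∣V∣ H ≡ v)))

Ism : ℕ → ℕ → ℕ → ℕ → ℕ → Set
Ism n r s k v =
  (Σ[ f ∈ Colouring n r ] IsM f s k v) ×
  ((f : Colouring n r) (w : ℕ) → IsM f s k w → v ℕ.≤ w)

{-# OPTIONS --safe #-}
module Submission where

open import Defs
open import Data.Nat using (ℕ; zero; suc; _+_; _*_; _∸_; _≤_; _<_; z≤n; s≤s)
open import Data.Nat.Properties
  using (≤-refl; ≤-trans; ≤-reflexive; ≤-antisym; <⇒≤; ≰⇒>; <⇒≱; ≤-pred; n<1+n; n≤1+n; <-≤-trans;
         m≤m+n; +-suc; +-comm; +-identityʳ; +-monoʳ-≤; +-monoˡ-≤; +-monoˡ-<; +-cancelˡ-≤;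
         m∸n+n≡m; ∸-monoʳ-≤; m+1+n≢0; n≤0⇒n≡0; _≤?_; _<?_; module ≤-Reasoning)
open import Data.Nat.Solver using (module +-*-Solver)
open import Data.Bool using (Bool; true; false; _∧_)
import Data.Bool.Properties as Bool
open import Data.Empty using (⊥; ⊥-elim)
open import Data.Fin as Fin using (Fin; toℕ; inject₁)
open import Data.Fin.Patterns using (0F; 1F; 2F; 3F)
open import Data.Fin.Properties using (any?; all?; <-irrelevant; toℕ<n)
open import Data.Fin.Subset using (Subset; _∈_; _∉_; _⊆_; ∣_∣; _∩_; _∪_; ∁; _-_; ⁅_⁆; ⊤; outside; inside)
open import Data.Fin.Subset.Properties
  using (_∈?_; _⊆?_; anySubset?; nonempty?; Empty-unique; p⊆q⇒∣p∣≤∣q∣; ∣p∣≤n; ∣⊥∣≡0; ∣⊤∣≡n;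
         x∈⁅x⁆; ∣⁅x⁆∣≡1; ∣∁p∣≡n∸∣p∣; x∈p⇒∣p-x∣<∣p∣; p─q⊆p; x∈p∧x≢y⇒x∈p-y;
         x∈p∩q⁺; x∈p∩q⁻; p∩q⊆p; ∣p∩q∣≤∣q∣; x∈p∪q⁺; x∈∁p⇒x∉p; x∉p⇒x∈∁p)
open import Data.Product using (Σ; Σ-syntax; ∃; _×_; _,_; proj₁; proj₂)
open import Data.Sum using (_⊎_; inj₁; inj₂; [_,_])
open import Data.Vec using (Vec; []; _∷_; lookup; tabulate)
open import Data.Vec.Properties using (lookup∘tabulate; []=⇒lookup; lookup⇒[]=)
open import Function using (_∘_)
open import Relation.Nullary using (¬_; Dec; yes; no; does; ¬?; _×-dec_; _⊎-dec_; _→-dec_)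
open import Relation.Nullary.Decidable using (map′; decidable-stable; isYes≗does; dec-true; from-yes)
open import Relation.Binary.PropositionalEquality
  using (_≡_; _≢_; _≗_; refl; sym; trans; cong; cong₂; subst; subst₂)

-- Split the vertices into three blocks A₀, A₁, A₂ of k - 1 consecutive vertices and a rest B.
-- Colour the edges inside A_c with c, those between two of the A's with the third colour, those
-- from A_c to B with c - 1 and those inside B with 0.  A k-connected H with at most two colours
-- misses some colour c, and stays connected after deleting its (at most k - 1) vertices in A_c.
-- Every edge from A_{c+1} to A_{c+2} ∪ B has colour c, so H avoids A_{c+1} or A_{c+2}, whence
-- |V(H)| ≤ n - (k - 1) when n ≥ 3(k - 1).  When B is empty, H then lies in A_c ∪ A_j for some j;
-- deleting its vertices in A_j leaves a connected graph inside A_c, where every edge would have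
-- the missing colour, so at most one vertex remains and |V(H)| ≤ k, contradicting k-connectivity.
-- That m is well defined needs the maxima and the minimum to exist: k-connectivity is decidable,
-- and colourings are determined by finite tables.

private
  variable
    n r s k : ℕ

∧-true⁻ : ∀ {a b} → a ∧ b ≡ true → a ≡ true × b ≡ true
∧-true⁻ {true} b≡true = refl , b≡true

∧-true⁺ : ∀ {a b} → a ≡ true → b ≡ true → a ∧ b ≡ true
∧-true⁺ refl refl = refl

∈-tabulate⁺ : ∀ {g : Fin n → Bool} {x} → g x ≡ true → x ∈ tabulate g
∈-tabulate⁺ {g = g} {x} gx≡true = lookup⇒[]= x (tabulate g) (trans (lookup∘tabulate g x) gx≡true)

∈-tabulate⁻ : ∀ {g : Fin n → Bool} {x} → x ∈ tabulate g → g x ≡ true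
∈-tabulate⁻ {g = g} {x} x∈ = trans (sym (lookup∘tabulate g x)) ([]=⇒lookup x∈)

anyFin⁺ : (p : Fin n → Bool) (i : Fin n) → p i ≡ true → anyFin p ≡ true
anyFin⁺ p Fin.zero    pi≡true rewrite pi≡true = refl
anyFin⁺ p (Fin.suc i) pi≡true with p Fin.zero
... | true  = refl
... | false = anyFin⁺ (p ∘ Fin.suc) i pi≡true

anyFin⁻ : (p : Fin n → Bool) → anyFin p ≡ true → ∃ λ i → p i ≡ true
anyFin⁻ {suc n} p any≡true with p Fin.zero in p0≡true
... | true  = Fin.zero , p0≡true
... | false = let i , pi≡true = anyFin⁻ (p ∘ Fin.suc) any≡true in Fin.suc i , pi≡true

module _ {n r : ℕ} (f : Colouring n r) (H : Subgraph n) where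

  ∈-usedColours⁺ : ∀ e → E H e ≡ true → f e ∈ usedColours f H
  ∈-usedColours⁺ e@((i , j) , i<j) e∈H =
    ∈-tabulate⁺ (anyFin⁺ _ i (anyFin⁺ _ j used))
    where
    used : usedAt f H (f e) i j ≡ true
    used with i Fin.<? j
    ... | no i≮j = ⊥-elim (i≮j i<j)
    ... | yes i<j′ rewrite <-irrelevant i<j′ i<j =
      ∧-true⁺ e∈H (trans (isYes≗does (f e Fin.≟ f e)) (dec-true (f e Fin.≟ f e) refl))

  ∈-usedColours⁻ : ∀ {c} → c ∈ usedColours f H → Σ[ e ∈ Edge n ] E H e ≡ true × f e ≡ c
  ∈-usedColours⁻ {c} c∈ =
    let i , row = anyFin⁻ _ (∈-tabulate⁻ c∈)
        j , used = anyFin⁻ _ row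
    in edge i j used
    where
    edge : ∀ i j → usedAt f H c i j ≡ true → Σ[ e ∈ Edge n ] E H e ≡ true × f e ≡ c
    edge i j used with i Fin.<? j
    ... | yes i<j with f ((i , j) , i<j) Fin.≟ c | ∧-true⁻ {E H ((i , j) , i<j)} used
    ...   | yes fe≡c | e∈H , _ = ((i , j) , i<j) , e∈H , fe≡c
    ...   | no _     | _ , ()

module _ {n : ℕ} {H : Subgraph n} where

  reach-end : ∀ {W u v} → Reach H W u v → W v
  reach-end (here Wv)     = Wv
  reach-end (step _ _ Wv) = Wv

  reach-map : ∀ {W W′ : Fin n → Set} {u v} → (∀ {x} → W x → W′ x) → Reach H W u v → Reach H W′ u v
  reach-map W⊆W′ (here Wu)      = here (W⊆W′ Wu)
  reach-map W⊆W′ (step r a Ww) = step (reach-map W⊆W′ r) a (W⊆W′ Ww)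

  reach-exit : ∀ {W u v} {P : Fin n → Set} → (∀ x → Dec (P x)) → Reach H W u v → P u → ¬ P v →
               Σ[ x ∈ Fin n ] Σ[ y ∈ Fin n ] (W x × W y) × (P x × ¬ P y) × Adj H x y
  reach-exit P? (here _) Pu ¬Pu = ⊥-elim (¬Pu Pu)
  reach-exit P? (step {v = x} {w = y} r x~y Wy) Pu ¬Py with P? x
  ... | yes Px = x , y , (reach-end r , Wy) , (Px , ¬Py) , x~y
  ... | no ¬Px = reach-exit P? r Pu ¬Px

  reach-edgeless : ∀ {W u v} → (∀ {x y} → W x → W y → ¬ Adj H x y) → Reach H W u v → u ≡ v
  reach-edgeless _         (here _)         = refl
  reach-edgeless edgeless (step r x~y Wy) = ⊥-elim (edgeless (reach-end r) Wy x~y)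

  private
    visits-or-avoids : ∀ {W u y} v → u ≢ v → Reach H W u y →
      (Σ[ w ∈ Fin n ] Adj H w v × Reach H (λ z → W z × z ≢ v) u w) ⊎ Reach H (λ z → W z × z ≢ v) u y
    visits-or-avoids v u≢v (here Wu) = inj₂ (here (Wu , u≢v))
    visits-or-avoids v u≢v (step {w = y} r x~y Wy) with visits-or-avoids v u≢v r
    ... | inj₁ visit = inj₁ visit
    ... | inj₂ r′ with y Fin.≟ v
    ...   | yes refl = inj₁ (_ , x~y , r′)
    ...   | no y≢v   = inj₂ (step r′ x~y (Wy , y≢v))

  reach-first-visit : ∀ {W u v} → u ≢ v → Reach H W u v →
                      Σ[ w ∈ Fin n ] Adj H w v × Reach H (λ z → W z × z ≢ v) u w
  reach-first-visit u≢v r with visits-or-avoids _ u≢v r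
  ... | inj₁ visit = visit
  ... | inj₂ r′    = ⊥-elim (proj₂ (reach-end r′) refl)

  adj? : ∀ u v → Dec (Adj H u v)
  adj? u v = edge? u v ⊎-dec edge? v u
    where
    edge? : ∀ x y → Dec (Σ[ p ∈ x Fin.< y ] E H ((x , y) , p) ≡ true)
    edge? x y with x Fin.<? y
    ... | no x≮y = no (x≮y ∘ proj₁)
    ... | yes p with E H ((x , y) , p) Bool.≟ true
    ...   | yes e = yes (p , e)
    ...   | no ¬e = no λ (q , e) → ¬e (subst (λ q → E H ((x , y) , q) ≡ true) (<-irrelevant q p) e)

  -- A walk to v ≠ u enters v from a neighbour reached without v, so deleting v shrinks the search.
  reach? : ∀ (W : Subset n) u v → Dec (Reach H (_∈ W) u v)
  reach? W = within (suc ∣ W ∣) W (n<1+n _)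
    where
    shrink : ∀ {fuel W v} → v ∈ W → ∣ W ∣ < suc fuel → ∣ W - v ∣ < fuel
    shrink v∈W ∣W∣<1+fuel = <-≤-trans (x∈p⇒∣p-x∣<∣p∣ v∈W) (≤-pred ∣W∣<1+fuel)
    within : ∀ fuel (W : Subset n) → ∣ W ∣ < fuel → ∀ u v → Dec (Reach H (_∈ W) u v)
    within (suc fuel) W ∣W∣<fuel u v with v ∈? W
    ... | no v∉W = no (v∉W ∘ reach-end)
    ... | yes v∈W with u Fin.≟ v
    ...   | yes refl = yes (here v∈W)
    ...   | no u≢v with any? (λ w → adj? w v ×-dec within fuel (W - v) (shrink v∈W ∣W∣<fuel) u w)
    ...     | yes (w , w~v , r) = yes (step (reach-map (p─q⊆p W _) r) w~v v∈W)
    ...     | no ∄w = no λ r →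
                let w , w~v , r′ = reach-first-visit u≢v r
                in ∄w (w , w~v , reach-map (λ (z∈W , z≢v) → x∈p∧x≢y⇒x∈p-y z∈W z≢v) r′)

  reach-mono-E : ∀ {H′ : Subgraph n} {W u v} → (∀ e → E H e ≡ true → E H′ e ≡ true) →
                 Reach H W u v → Reach H′ W u v
  reach-mono-E H⊆H′ (here Wu)     = here Wu
  reach-mono-E {H′} H⊆H′ (step r a Ww) = step (reach-mono-E H⊆H′ r) (adj-mono a) Ww
    where
    adj-mono : ∀ {x y} → Adj H x y → Adj H′ x y
    adj-mono (inj₁ (p , e)) = inj₁ (p , H⊆H′ _ e)
    adj-mono (inj₂ (p , e)) = inj₂ (p , H⊆H′ _ e)

∣p∪q∣≤∣p∣+∣q∣ : ∀ (p q : Subset n) → ∣ p ∪ q ∣ ≤ ∣ p ∣ + ∣ q ∣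
∣p∪q∣≤∣p∣+∣q∣ []            []            = z≤n
∣p∪q∣≤∣p∣+∣q∣ (outside ∷ p) (outside ∷ q) = ∣p∪q∣≤∣p∣+∣q∣ p q
∣p∪q∣≤∣p∣+∣q∣ (outside ∷ p) (inside ∷ q)  = ≤-trans (s≤s (∣p∪q∣≤∣p∣+∣q∣ p q)) (≤-reflexive (sym (+-suc _ _)))
∣p∪q∣≤∣p∣+∣q∣ (inside ∷ p)  (outside ∷ q) = s≤s (∣p∪q∣≤∣p∣+∣q∣ p q)
∣p∪q∣≤∣p∣+∣q∣ (inside ∷ p)  (inside ∷ q)  = s≤s (≤-trans (∣p∪q∣≤∣p∣+∣q∣ p q) (+-monoʳ-≤ ∣ p ∣ (n≤1+n _)))

∣p∣≤1 : ∀ {p : Subset n} → (∀ {x y} → x ∈ p → y ∈ p → x ≡ y) → ∣ p ∣ ≤ 1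
∣p∣≤1 {n} {p} all-equal with nonempty? p
... | yes (x , x∈p) = ≤-trans (p⊆q⇒∣p∣≤∣q∣ (λ y∈p → subst (_∈ ⁅ x ⁆) (all-equal x∈p y∈p) (x∈⁅x⁆ x)))
                              (≤-reflexive (∣⁅x⁆∣≡1 x))
... | no empty = subst (_≤ 1) (sym (trans (cong ∣_∣ (Empty-unique empty)) (∣⊥∣≡0 n))) z≤n

∃-∉ : ∀ {p : Subset n} → ∣ p ∣ < n → ∃ λ x → x ∉ p
∃-∉ {n} {p} ∣p∣<n with any? (λ x → ¬? (x ∈? p))
... | yes x∉p = x∉p
... | no ∄    = ⊥-elim (<⇒≱ ∣p∣<n (≤-trans (≤-reflexive (sym (∣⊤∣≡n n)))
                  (p⊆q⇒∣p∣≤∣q∣ {p = ⊤} λ {x} _ → decidable-stable (x ∈? p) (λ x∉p → ∄ (x , x∉p)))))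

decSubset : ∀ {P : Fin n → Set} → (∀ x → Dec (P x)) → Subset n
decSubset P? = tabulate (does ∘ P?)

module _ {n : ℕ} {P : Fin n → Set} (P? : ∀ x → Dec (P x)) where

  ∈-decSubset⁺ : ∀ {x} → P x → x ∈ decSubset P?
  ∈-decSubset⁺ {x} Px = ∈-tabulate⁺ (dec-true (P? x) Px)

  ∈-decSubset⁻ : ∀ {x} → x ∈ decSubset P? → P x
  ∈-decSubset⁻ {x} x∈ with P? x | ∈-tabulate⁻ {g = does ∘ P?} x∈
  ... | yes Px | _ = Px

-- The vertices x with a ≤ toℕ x < a + l, phrased with _<?_ alone so that
-- interval {suc n} (suc a) l reduces to outside ∷ interval {n} a l.
interval : ℕ → ℕ → Subset n
interval a l = decSubset λ x → ¬? (toℕ x <? a) ×-dec (toℕ x <? a + l)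

∣interval∣≤ : ∀ n a l → ∣ interval {n} a l ∣ ≤ l
∣interval∣≤ zero    a       l       = z≤n
∣interval∣≤ (suc n) (suc a) l       = ∣interval∣≤ n a l
∣interval∣≤ (suc n) zero    zero    = ∣interval∣≤ n 0 0
∣interval∣≤ (suc n) zero    (suc l) = s≤s (∣interval∣≤ n 0 l)

∣interval∣≥ : ∀ n a l → a + l ≤ n → l ≤ ∣ interval {n} a l ∣
∣interval∣≥ n       a       zero    _           = z≤n
∣interval∣≥ (suc n) (suc a) l       (s≤s a+l≤n) = ∣interval∣≥ n a l a+l≤n
∣interval∣≥ (suc n) zero    (suc l) (s≤s l≤n)   = s≤s (∣interval∣≥ n 0 l l≤n)

-- k-connected graphs

remainder-has-edge : ∀ {n k} {H : Subgraph n} {S : Subset n} → KConnected k H → S ⊆ V H → ∣ S ∣ < k →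
  ¬ (∀ {x y} → x ∈ V H × x ∉ S → y ∈ V H × y ∉ S → ¬ Adj H x y)
remainder-has-edge {n} {k} {H} {S} (k+1≤∣V∣ , conn) S⊆V ∣S∣<k edgeless = <⇒≱ ∣V∣<k+1 k+1≤∣V∣
  where
  R : Subset n
  R = V H ∩ ∁ S
  ∣R∣≤1 : ∣ R ∣ ≤ 1
  ∣R∣≤1 = ∣p∣≤1 λ x∈R y∈R →
    let x∈ , x∈∁S = x∈p∩q⁻ (V H) (∁ S) x∈R ; y∈ , y∈∁S = x∈p∩q⁻ (V H) (∁ S) y∈R
    in reach-edgeless edgeless (conn S S⊆V ∣S∣<k _ _ x∈ (x∈∁p⇒x∉p x∈∁S) y∈ (x∈∁p⇒x∉p y∈∁S))
  V⊆S∪R : V H ⊆ S ∪ R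
  V⊆S∪R {x} x∈ with x ∈? S
  ... | yes x∈S = x∈p∪q⁺ (inj₁ x∈S)
  ... | no x∉S  = x∈p∪q⁺ (inj₂ (x∈p∩q⁺ (x∈ , x∉p⇒x∈∁p x∉S)))
  ∣V∣<k+1 : ∣ V H ∣ < k + 1
  ∣V∣<k+1 = begin-strict
    ∣ V H ∣         ≤⟨ p⊆q⇒∣p∣≤∣q∣ V⊆S∪R ⟩
    ∣ S ∪ R ∣       ≤⟨ ∣p∪q∣≤∣p∣+∣q∣ S R ⟩
    ∣ S ∣ + ∣ R ∣   ≤⟨ +-monoʳ-≤ ∣ S ∣ ∣R∣≤1 ⟩
    ∣ S ∣ + 1       <⟨ +-monoˡ-< 1 ∣S∣<k ⟩
    k + 1           ∎
    where open ≤-Reasoning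

allSubsets? : ∀ {P : Subset n → Set} → (∀ S → Dec (P S)) → Dec (∀ S → P S)
allSubsets? P? with anySubset? (¬? ∘ P?)
... | yes (S , ¬PS) = no λ ∀P → ¬PS (∀P S)
... | no ∄¬P        = yes λ S → decidable-stable (P? S) λ ¬PS → ∄¬P (S , ¬PS)

module _ {n : ℕ} (H : Subgraph n) where

  connectedMinus? : ∀ S → Dec (ConnectedMinus H S)
  connectedMinus? S =
    map′ (λ conn u v u∈ u∉ v∈ v∉ → reach-map to (conn u v u∈ u∉ v∈ v∉))
         (λ conn u v u∈ u∉ v∈ v∉ → reach-map from (conn u v u∈ u∉ v∈ v∉))
         (all? λ u → all? λ v →
            u ∈? V H →-dec ¬? (u ∈? S) →-dec v ∈? V H →-dec ¬? (v ∈? S) →-dec reach? (V H ∩ ∁ S) u v)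
    where
    to : ∀ {x} → x ∈ V H ∩ ∁ S → x ∈ V H × x ∉ S
    to x∈ = let x∈V , x∈∁S = x∈p∩q⁻ (V H) (∁ S) x∈ in x∈V , x∈∁p⇒x∉p x∈∁S
    from : ∀ {x} → x ∈ V H × x ∉ S → x ∈ V H ∩ ∁ S
    from (x∈V , x∉S) = x∈p∩q⁺ (x∈V , x∉p⇒x∈∁p x∉S)

  kConnected? : ∀ k → Dec (KConnected k H)
  kConnected? k = (k + 1 ≤? ∣ V H ∣) ×-dec
                  allSubsets? (λ S → S ⊆? V H →-dec ∣ S ∣ <? k →-dec connectedMinus? S)

KConnected-mono-E : ∀ {k} (H H′ : Subgraph n) → V H ≡ V H′ → (∀ e → E H e ≡ true → E H′ e ≡ true) →
                    KConnected k H → KConnected k H′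
KConnected-mono-E H record { V = _ ; E = _ ; closed = _ } refl H⊆H′ (size , conn) =
  size , λ S S⊆V ∣S∣<k u v u∈ u∉ v∈ v∉ → reach-mono-E H⊆H′ (conn S S⊆V ∣S∣<k u v u∈ u∉ v∈ v∉)

-- Existence of M(f,n,r,s,k) and m(n,r,s,k)

argmax-Subset : ∀ {P : Subset n → Set} → (∀ S → Dec (P S)) → (g : Subset n → ℕ) →
                (∀ S → ¬ P S) ⊎ Σ[ S ∈ Subset n ] P S × (∀ S′ → P S′ → g S′ ≤ g S)
argmax-Subset {zero} P? g with P? []
... | yes P[] = inj₂ ([] , P[] , λ { [] _ → ≤-refl })
... | no ¬P[] = inj₁ λ { [] → ¬P[] }
argmax-Subset {suc n} P? g
  with argmax-Subset (P? ∘ (inside ∷_)) (g ∘ (inside ∷_))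
     | argmax-Subset (P? ∘ (outside ∷_)) (g ∘ (outside ∷_))
... | inj₁ ∄in | inj₁ ∄out = inj₁ λ { (inside ∷ S) → ∄in S ; (outside ∷ S) → ∄out S }
... | inj₂ (S , PS , max) | inj₁ ∄out =
  inj₂ (inside ∷ S , PS , λ { (inside ∷ S′) → max S′ ; (outside ∷ S′) PS′ → ⊥-elim (∄out S′ PS′) })
... | inj₁ ∄in | inj₂ (S , PS , max) =
  inj₂ (outside ∷ S , PS , λ { (outside ∷ S′) → max S′ ; (inside ∷ S′) PS′ → ⊥-elim (∄in S′ PS′) })
... | inj₂ (S , PS , max) | inj₂ (T , PT , maxT) with g (inside ∷ S) ≤? g (outside ∷ T)
...   | yes ≤T = inj₂ (outside ∷ T , PT , λ { (outside ∷ S′) → maxT S′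
                                           ; (inside ∷ S′) PS′ → ≤-trans (max S′ PS′) ≤T })
...   | no ≰T  = inj₂ (inside ∷ S , PS , λ { (inside ∷ S′) → max S′
                                         ; (outside ∷ S′) PS′ → ≤-trans (maxT S′ PS′) (<⇒≤ (≰⇒> ≰T)) })

module _ {n r : ℕ} (f : Colouring n r) where

  spanned : Subset n → Subset r → Subgraph n
  spanned W C = record
    { V      = W
    ; E      = λ e → lookup W (proj₁ (proj₁ e)) ∧ lookup W (proj₂ (proj₁ e)) ∧ lookup C (f e)
    ; closed = λ e e∈ →
        let i∈ , j∈C = ∧-true⁻ e∈ ; j∈ , _ = ∧-true⁻ j∈C
        in lookup⇒[]= _ W i∈ , lookup⇒[]= _ W j∈
    }

  c[spanned]≤∣C∣ : ∀ W C → c[ f ] (spanned W C) ≤ ∣ C ∣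
  c[spanned]≤∣C∣ W C = p⊆q⇒∣p∣≤∣q∣ λ c∈ →
    let e , e∈ , fe≡c = ∈-usedColours⁻ f (spanned W C) c∈
        _ , j∈C = ∧-true⁻ {lookup W (proj₁ (proj₁ e))} e∈
        _ , fe∈C = ∧-true⁻ {lookup W (proj₂ (proj₁ e))} j∈C
    in lookup⇒[]= _ C (subst (λ c → lookup C c ≡ true) fe≡c fe∈C)

  module _ (s k : ℕ) where

    Spannable : Subset n → Set
    Spannable W = Σ[ C ∈ Subset r ] ∣ C ∣ ≤ s × KConnected k (spanned W C)

    good⇒spannable : ∀ H → Good f s k H → Spannable (V H)
    good⇒spannable H (conn , c≤s) =
      usedColours f H , c≤s , KConnected-mono-E H (spanned (V H) (usedColours f H)) refl H⊆spanned conn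
      where
      H⊆spanned : ∀ e → E H e ≡ true → E (spanned (V H) (usedColours f H)) e ≡ true
      H⊆spanned e e∈H = let i∈ , j∈ = closed H e e∈H in
        ∧-true⁺ ([]=⇒lookup i∈) (∧-true⁺ ([]=⇒lookup j∈) ([]=⇒lookup (∈-usedColours⁺ f H e e∈H)))

    M-exists : Σ ℕ (IsM f s k)
    M-exists with argmax-Subset (λ W → anySubset? λ C → ∣ C ∣ ≤? s ×-dec kConnected? (spanned W C) k) ∣_∣
    ... | inj₁ ∄W = 0 , (λ H good → ⊥-elim (∄W _ (good⇒spannable H good)))
                      , inj₁ (refl , λ H good → ∄W _ (good⇒spannable H good))
    ... | inj₂ (W , (C , ∣C∣≤s , conn) , max) =
      ∣ W ∣ , (λ H good → max (V H) (good⇒spannable H good))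
            , inj₂ (spanned W C , (conn , ≤-trans (c[spanned]≤∣C∣ W C) ∣C∣≤s) , refl)

module _ {n r s k : ℕ} {f : Colouring n r} where

  IsM-≤ : ∀ {w b} → (∀ H → Good f s k H → ∣V∣ H ≤ b) → IsM f s k w → w ≤ b
  IsM-≤ bound (_ , inj₁ (refl , _))         = z≤n
  IsM-≤ bound (_ , inj₂ (H , good , refl)) = bound H good

  IsM-none : (∀ H → ¬ Good f s k H) → IsM f s k 0
  IsM-none none = (λ H good → ⊥-elim (none H good)) , inj₁ (refl , none)

  IsM-unique : ∀ {w w′} → IsM f s k w → IsM f s k w′ → w ≡ w′
  IsM-unique (_ , inj₁ (refl , _))       (_ , inj₁ (refl , _))       = refl
  IsM-unique (_ , inj₁ (_ , none))       (_ , inj₂ (H , good , _))   = ⊥-elim (none H good)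
  IsM-unique (_ , inj₂ (H , good , _))   (_ , inj₁ (_ , none))       = ⊥-elim (none H good)
  IsM-unique (max , inj₂ (H , good , refl)) (max′ , inj₂ (H′ , good′ , refl)) =
    ≤-antisym (max′ H good) (max H′ good′)

Ism-≤n : ∀ {v} → Ism n r s k v → v ≤ n
Ism-≤n ((f , isM) , _) = IsM-≤ {f = f} (λ H _ → ∣p∣≤n (V H)) isM

missing-colour : ∀ {f : Colouring n r} {H} → Good f s k H → s < r → ∃ λ c → c ∉ usedColours f H
missing-colour (_ , c≤s) s<r = ∃-∉ (<-≤-trans (s≤s c≤s) s<r)

Good-cong : ∀ {f g : Colouring n r} → f ≗ g → ∀ H → Good f s k H → Good g s k H
Good-cong {f = f} {g} f≗g H (conn , c≤s) = conn , ≤-trans (p⊆q⇒∣p∣≤∣q∣ used⊆) c≤s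
  where
  used⊆ : usedColours g H ⊆ usedColours f H
  used⊆ c∈ = let e , e∈H , ge≡c = ∈-usedColours⁻ g H c∈ in
    subst (_∈ usedColours f H) (trans (f≗g e) ge≡c) (∈-usedColours⁺ f H e e∈H)

IsM-cong : ∀ {f g : Colouring n r} {w} → f ≗ g → IsM f s k w → IsM g s k w
IsM-cong f≗g (max , inj₁ (w≡0 , none)) =
  (λ H good → max H (Good-cong (sym ∘ f≗g) H good)) ,
  inj₁ (w≡0 , λ H good → none H (Good-cong (sym ∘ f≗g) H good))
IsM-cong f≗g (max , inj₂ (H , good , ∣V∣≡w)) =
  (λ H good → max H (Good-cong (sym ∘ f≗g) H good)) , inj₂ (H , Good-cong f≗g H good , ∣V∣≡w)

ArgMin : Set → Set
ArgMin A = (h : A → ℕ) → Σ[ a ∈ A ] (∀ b → h a ≤ h b)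

argmin-Fin : ∀ r → ArgMin (Fin (suc r))
argmin-Fin zero    h = Fin.zero , λ { Fin.zero → ≤-refl }
argmin-Fin (suc r) h with argmin-Fin r (h ∘ Fin.suc)
... | a , min with h Fin.zero ≤? h (Fin.suc a)
...   | yes ≤a = Fin.zero , λ { Fin.zero → ≤-refl ; (Fin.suc b) → ≤-trans ≤a (min b) }
...   | no ≰a  = Fin.suc a , λ { Fin.zero → <⇒≤ (≰⇒> ≰a) ; (Fin.suc b) → min b }

argmin-Vec : ∀ {A} → ArgMin A → ∀ n → ArgMin (Vec A n)
argmin-Vec argmin-A zero h = [] , λ { [] → ≤-refl }
argmin-Vec {A} argmin-A (suc n) h =
  a ∷ proj₁ (best-tail a) , λ { (b ∷ bs) → ≤-trans (a-min b) (proj₂ (best-tail b) bs) }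
  where
  best-tail : ∀ a → Σ[ as ∈ Vec A n ] (∀ bs → h (a ∷ as) ≤ h (a ∷ bs))
  best-tail a = argmin-Vec argmin-A n (h ∘ (a ∷_))
  best-head : Σ[ a ∈ A ] (∀ b → h (a ∷ proj₁ (best-tail a)) ≤ h (b ∷ proj₁ (best-tail b)))
  best-head = argmin-A (λ a → h (a ∷ proj₁ (best-tail a)))
  a : A
  a = proj₁ best-head
  a-min : ∀ b → h (a ∷ proj₁ (best-tail a)) ≤ h (b ∷ proj₁ (best-tail b))
  a-min = proj₂ best-head

-- Colourings are functions, so the minimum over them is taken over their (finitely many) tables.
Table : ℕ → ℕ → Set
Table n r = Vec (Vec (Fin r) n) n

colouringOf : Table n r → Colouring n r
colouringOf t ((i , j) , _) = lookup (lookup t i) j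

tableEntry : Colouring n (suc r) → Fin n → Fin n → Fin (suc r)
tableEntry f i j with i Fin.<? j
... | yes i<j = f ((i , j) , i<j)
... | no _    = Fin.zero

tableOf : Colouring n (suc r) → Table n (suc r)
tableOf f = tabulate λ i → tabulate (tableEntry f i)

colouringOf-tableOf : (f : Colouring n (suc r)) → colouringOf (tableOf f) ≗ f
colouringOf-tableOf f ((i , j) , i<j)
  rewrite lookup∘tabulate (λ i → tabulate (tableEntry f i)) i | lookup∘tabulate (tableEntry f i) j
  with i Fin.<? j
... | yes i<j′ rewrite <-irrelevant i<j′ i<j = refl
... | no i≮j = ⊥-elim (i≮j i<j)

m-exists : ∀ n r s k → Σ ℕ (Ism n (suc r) s k)
m-exists n r s k = M (colouringOf best) , (colouringOf best , M-isM (colouringOf best)) , minimal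
  where
  M : Colouring n (suc r) → ℕ
  M f = proj₁ (M-exists f s k)
  M-isM : ∀ f → IsM f s k (M f)
  M-isM f = proj₂ (M-exists f s k)
  best-table : Σ[ t ∈ Table n (suc r) ] (∀ t′ → M (colouringOf t) ≤ M (colouringOf t′))
  best-table = argmin-Vec (argmin-Vec (argmin-Fin r) n) n (M ∘ colouringOf)
  best : Table n (suc r)
  best = proj₁ best-table
  minimal : ∀ f w → IsM f s k w → M (colouringOf best) ≤ w
  minimal f w isM = ≤-trans (proj₂ best-table (tableOf f))
    (≤-reflexive (IsM-unique (M-isM _) (IsM-cong (sym ∘ colouringOf-tableOf f) isM)))

-- The colouring

-- Row and column inject₁ c stand for the block A_c, and 3F for the rest B.
crossTable : Vec (Vec (Fin 3) 4) 4
crossTable = (0F ∷ 2F ∷ 1F ∷ 2F ∷ [])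
           ∷ (2F ∷ 1F ∷ 0F ∷ 0F ∷ [])
           ∷ (1F ∷ 0F ∷ 2F ∷ 1F ∷ [])
           ∷ (2F ∷ 0F ∷ 1F ∷ 0F ∷ [])
           ∷ []

cross : Fin 4 → Fin 4 → Fin 3
cross a b = lookup (lookup crossTable a) b

next prev : Fin 3 → Fin 3
next 0F = 1F
next 1F = 2F
next 2F = 0F
prev 0F = 2F
prev 1F = 0F
prev 2F = 1F

cross-sym : ∀ a b → cross a b ≡ cross b a
cross-sym = from-yes (all? λ a → all? λ b → cross a b Fin.≟ cross b a)

cross-diag : ∀ c → cross (inject₁ c) (inject₁ c) ≡ c
cross-diag = from-yes (all? λ c → cross (inject₁ c) (inject₁ c) Fin.≟ c)

cross-next : ∀ c a → a ≢ inject₁ c → a ≢ inject₁ (next c) → cross (inject₁ (next c)) a ≡ c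
cross-next = from-yes (all? λ c → all? λ a →
  ¬? (a Fin.≟ inject₁ c) →-dec ¬? (a Fin.≟ inject₁ (next c)) →-dec cross (inject₁ (next c)) a Fin.≟ c)

next≢ : ∀ c → inject₁ (next c) ≢ inject₁ c
next≢ = from-yes (all? λ c → ¬? (inject₁ (next c) Fin.≟ inject₁ c))

prev≢ : ∀ c → inject₁ (prev c) ≢ inject₁ c × inject₁ (prev c) ≢ inject₁ (next c)
prev≢ = from-yes (all? λ c →
  ¬? (inject₁ (prev c) Fin.≟ inject₁ c) ×-dec ¬? (inject₁ (prev c) Fin.≟ inject₁ (next c)))

block-cases : ∀ c a → a ≢ 3F → a ≢ inject₁ (next c) → a ≡ inject₁ c ⊎ a ≡ inject₁ (prev c)
block-cases = from-yes (all? λ c → all? λ a →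
  ¬? (a Fin.≟ 3F) →-dec ¬? (a Fin.≟ inject₁ (next c)) →-dec
  (a Fin.≟ inject₁ c ⊎-dec a Fin.≟ inject₁ (prev c)))

module _ {n : ℕ} (part : Fin n → Fin 4) where

  blockColouring : Colouring n 3
  blockColouring ((i , j) , _) = cross (part i) (part j)

  block : Fin 4 → Subset n
  block a = decSubset λ x → part x Fin.≟ a

  ∈-block⁺ : ∀ {a x} → part x ≡ a → x ∈ block a
  ∈-block⁺ {a} = ∈-decSubset⁺ (λ x → part x Fin.≟ a)

  ∈-block⁻ : ∀ {a x} → x ∈ block a → part x ≡ a
  ∈-block⁻ {a} = ∈-decSubset⁻ (λ x → part x Fin.≟ a)

  module _ (H : Subgraph n) {c : Fin 3} (c∉H : c ∉ usedColours blockColouring H) where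

    adj-colour≢ : ∀ {u v} → Adj H u v → cross (part u) (part v) ≢ c
    adj-colour≢ (inj₁ (u<v , e∈H)) refl = c∉H (∈-usedColours⁺ blockColouring H _ e∈H)
    adj-colour≢ {u} {v} (inj₂ (v<u , e∈H)) c≡ =
      c∉H (subst (_∈ usedColours blockColouring H) (trans (cross-sym (part v) (part u)) c≡)
                 (∈-usedColours⁺ blockColouring H _ e∈H))

    misses-next⊎within : ∀ {m} → KConnected (suc m) H → ∣ block (inject₁ c) ∣ ≤ m →
      (∀ x → x ∈ V H → part x ≢ inject₁ (next c)) ⊎
      (∀ x → x ∈ V H → part x ≡ inject₁ c ⊎ part x ≡ inject₁ (next c))
    misses-next⊎within (_ , conn) ∣A∣≤m with any? (λ x → x ∈? V H ×-dec part x Fin.≟ inject₁ (next c))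
    ... | no ∄x = inj₁ λ x x∈ x-next → ∄x (x , x∈ , x-next)
    ... | yes (x₀ , x₀∈ , x₀-next) = inj₂ λ y y∈ →
      decidable-stable (part y Fin.≟ inject₁ c ⊎-dec part y Fin.≟ inject₁ (next c))
        λ y∉ → stuck y∈ (y∉ ∘ inj₁) (y∉ ∘ inj₂)
      where
      S : Subset n
      S = V H ∩ block (inject₁ c)
      outside-S : ∀ {x} → part x ≢ inject₁ c → x ∉ S
      outside-S x≢c x∈S = x≢c (∈-block⁻ (proj₂ (x∈p∩q⁻ (V H) _ x∈S)))
      H-S : ConnectedMinus H S
      H-S = conn S (p∩q⊆p (V H) _) (s≤s (≤-trans (∣p∩q∣≤∣q∣ (V H) _) ∣A∣≤m))
      stuck : ∀ {y} → y ∈ V H → part y ≢ inject₁ c → part y ≢ inject₁ (next c) → ⊥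
      stuck {y} y∈ y≢c y≢next
        with reach-exit (λ x → part x Fin.≟ inject₁ (next c))
               (H-S x₀ y x₀∈ (outside-S (λ x₀≡c → next≢ c (trans (sym x₀-next) x₀≡c))) y∈ (outside-S y≢c))
               x₀-next y≢next
      ... | u , v , (_ , (v∈ , v∉S)) , (u-next , v≢next) , u~v =
        adj-colour≢ u~v (trans (cong (λ a → cross a (part v)) u-next)
          (cross-next c (part v) (λ v≡c → v∉S (x∈p∩q⁺ (v∈ , ∈-block⁺ v≡c))) v≢next))

    misses-block : ∀ {m} → KConnected (suc m) H → ∣ block (inject₁ c) ∣ ≤ m →
                   Σ[ j ∈ Fin 3 ] (∀ x → x ∈ V H → part x ≢ inject₁ j)
    misses-block conn ∣A∣≤m with misses-next⊎within conn ∣A∣≤m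
    ... | inj₁ misses-next = next c , misses-next
    ... | inj₂ within      = prev c , λ x x∈ x≡prev →
      [ (λ x≡c → proj₁ (prev≢ c) (trans (sym x≡prev) x≡c))
      , (λ x≡next → proj₂ (prev≢ c) (trans (sym x≡prev) x≡next)) ] (within x x∈)

    within-two-blocks : ∀ {m} → KConnected (suc m) H → ∣ block (inject₁ c) ∣ ≤ m → (∀ x → part x ≢ 3F) →
                        Σ[ j ∈ Fin 3 ] (∀ x → x ∈ V H → part x ≡ inject₁ c ⊎ part x ≡ inject₁ j)
    within-two-blocks conn ∣A∣≤m no-rest with misses-next⊎within conn ∣A∣≤m
    ... | inj₁ misses-next = prev c , λ x x∈ → block-cases c (part x) (no-rest x) (misses-next x x∈)
    ... | inj₂ within      = next c , within

    ¬within-two-blocks : ∀ {m j} → KConnected (suc m) H → ∣ block (inject₁ j) ∣ ≤ m →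
                         ¬ (∀ x → x ∈ V H → part x ≡ inject₁ c ⊎ part x ≡ inject₁ j)
    ¬within-two-blocks {j = j} conn ∣B∣≤m within =
      remainder-has-edge conn (p∩q⊆p (V H) _) (s≤s (≤-trans (∣p∩q∣≤∣q∣ (V H) _) ∣B∣≤m))
        λ (x∈ , x∉S) (y∈ , y∉S) x~y →
          adj-colour≢ x~y (trans (cong₂ cross (in-c x∈ x∉S) (in-c y∈ y∉S)) (cross-diag c))
      where
      in-c : ∀ {x} → x ∈ V H → x ∉ V H ∩ block (inject₁ j) → part x ≡ inject₁ c
      in-c {x} x∈ x∉S =
        [ (λ x≡c → x≡c) , (λ x≡j → ⊥-elim (x∉S (x∈p∩q⁺ (x∈ , ∈-block⁺ x≡j)))) ] (within x x∈)

module BlockPartition (m : ℕ) where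

  start : Fin 3 → ℕ
  start 0F = 0
  start 1F = m
  start 2F = m + m

  private
    classify : ∀ {i} → Dec (i < m) → Dec (i < m + m) → Dec (i < m + m + m) → Fin 4
    classify (yes _) _       _       = 0F
    classify (no _)  (yes _) _       = 1F
    classify (no _)  (no _)  (yes _) = 2F
    classify (no _)  (no _)  (no _)  = 3F

    classify⁻ : ∀ c {i} (d₁ : Dec (i < m)) d₂ d₃ →
                classify d₁ d₂ d₃ ≡ inject₁ c → ¬ i < start c × i < start c + m
    classify⁻ 0F (yes i<m)  _           _           refl = (λ ()) , i<m
    classify⁻ 1F (no i≮m)   (yes i<2m)  _           refl = i≮m , i<2m
    classify⁻ 2F (no _)     (no i≮2m)   (yes i<3m)  refl = i≮2m , i<3m
    classify⁻ 0F (no _)     (yes _)     _           ()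
    classify⁻ 0F (no _)     (no _)      (yes _)     ()
    classify⁻ 0F (no _)     (no _)      (no _)      ()
    classify⁻ 1F (yes _)    _           _           ()
    classify⁻ 1F (no _)     (no _)      (yes _)     ()
    classify⁻ 1F (no _)     (no _)      (no _)      ()
    classify⁻ 2F (yes _)    _           _           ()
    classify⁻ 2F (no _)     (yes _)     _           ()
    classify⁻ 2F (no _)     (no _)      (no _)      ()

    classify⁺ : ∀ c {i} (d₁ : Dec (i < m)) d₂ d₃ →
                ¬ i < start c → i < start c + m → classify d₁ d₂ d₃ ≡ inject₁ c
    classify⁺ 0F (yes _)    _          _          _    _    = refl
    classify⁺ 1F (no _)     (yes _)    _          _    _    = refl
    classify⁺ 2F (no _)     (no _)     (yes _)    _    _    = refl
    classify⁺ 0F (no i≮m)   _          _          _    i<m  = ⊥-elim (i≮m i<m)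
    classify⁺ 1F (yes i<m)  _          _          i≮m  _    = ⊥-elim (i≮m i<m)
    classify⁺ 1F (no _)     (no i≮2m)  _          _    i<2m = ⊥-elim (i≮2m i<2m)
    classify⁺ 2F (yes i<m)  _          _          i≮2m _    = ⊥-elim (i≮2m (<-≤-trans i<m (m≤m+n m m)))
    classify⁺ 2F (no _)     (yes i<2m) _          i≮2m _    = ⊥-elim (i≮2m i<2m)
    classify⁺ 2F (no _)     (no _)     (no i≮3m)  _    i<3m = ⊥-elim (i≮3m i<3m)

    classify≢3F : ∀ {i} (d₁ : Dec (i < m)) d₂ d₃ → i < m + m + m → classify d₁ d₂ d₃ ≢ 3F
    classify≢3F (yes _) _       _         _    = λ ()
    classify≢3F (no _)  (yes _) _         _    = λ ()
    classify≢3F (no _)  (no _)  (yes _)   _    = λ ()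
    classify≢3F (no _)  (no _)  (no i≮3m) i<3m = λ _ → i≮3m i<3m

  blockOf : ℕ → Fin 4
  blockOf i = classify (i <? m) (i <? m + m) (i <? m + m + m)

  blockOf≡⁻ : ∀ c i → blockOf i ≡ inject₁ c → ¬ i < start c × i < start c + m
  blockOf≡⁻ c i = classify⁻ c (i <? m) (i <? m + m) (i <? m + m + m)

  blockOf≡⁺ : ∀ c i → ¬ i < start c → i < start c + m → blockOf i ≡ inject₁ c
  blockOf≡⁺ c i = classify⁺ c (i <? m) (i <? m + m) (i <? m + m + m)

  blockOf≢3F : ∀ i → i < m + m + m → blockOf i ≢ 3F
  blockOf≢3F i = classify≢3F (i <? m) (i <? m + m) (i <? m + m + m)

  start+m≤3m : ∀ c → start c + m ≤ m + m + m
  start+m≤3m 0F = ≤-trans (m≤m+n m m) (m≤m+n (m + m) m)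
  start+m≤3m 1F = m≤m+n (m + m) m
  start+m≤3m 2F = ≤-refl

  partition : Fin n → Fin 4
  partition x = blockOf (toℕ x)

  module _ {n : ℕ} (c : Fin 3) where

    private
      in-interval? : ∀ (x : Fin n) → Dec (¬ toℕ x < start c × toℕ x < start c + m)
      in-interval? x = ¬? (toℕ x <? start c) ×-dec (toℕ x <? start c + m)

    ∣block∣≤m : ∣ block (partition {n}) (inject₁ c) ∣ ≤ m
    ∣block∣≤m = ≤-trans (p⊆q⇒∣p∣≤∣q∣ block⊆interval) (∣interval∣≤ n (start c) m)
      where
      block⊆interval : block (partition {n}) (inject₁ c) ⊆ interval (start c) m
      block⊆interval x∈ = ∈-decSubset⁺ in-interval? (blockOf≡⁻ c _ (∈-block⁻ partition x∈))

    ∣block∣≥m : m + m + m ≤ n → m ≤ ∣ block (partition {n}) (inject₁ c) ∣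
    ∣block∣≥m 3m≤n =
      ≤-trans (∣interval∣≥ n (start c) m (≤-trans (start+m≤3m c) 3m≤n)) (p⊆q⇒∣p∣≤∣q∣ interval⊆block)
      where
      interval⊆block : interval (start c) m ⊆ block (partition {n}) (inject₁ c)
      interval⊆block x∈ = let i≮start , i<end = ∈-decSubset⁻ in-interval? x∈ in
        ∈-block⁺ partition (blockOf≡⁺ c _ i≮start i<end)

  partition≢3F : ∀ {n} → n ≤ m + m + m → (x : Fin n) → partition x ≢ 3F
  partition≢3F n≤3m x = blockOf≢3F (toℕ x) (<-≤-trans (toℕ<n x) n≤3m)

module _ (m : ℕ) {n : ℕ} where
  open BlockPartition m

  private
    part : Fin n → Fin 4
    part = partition

  extremalColouring : Colouring n 3
  extremalColouring = blockColouring part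

  good⇒∣V∣≤n∸m : m + m + m ≤ n → ∀ H → Good extremalColouring 2 (suc m) H → ∣V∣ H ≤ n ∸ m
  good⇒∣V∣≤n∸m 3m≤n H good@(conn , _) =
    let c , c∉H = missing-colour good (s≤s ≤-refl)
        j , misses = misses-block part H c∉H conn (∣block∣≤m {n} c)
        V⊆∁block : V H ⊆ ∁ (block part (inject₁ j))
        V⊆∁block x∈ = x∉p⇒x∈∁p (misses _ x∈ ∘ ∈-block⁻ part)
    in begin
      ∣ V H ∣                         ≤⟨ p⊆q⇒∣p∣≤∣q∣ V⊆∁block ⟩
      ∣ ∁ (block part (inject₁ j)) ∣  ≡⟨ ∣∁p∣≡n∸∣p∣ (block part (inject₁ j)) ⟩
      n ∸ ∣ block part (inject₁ j) ∣  ≤⟨ ∸-monoʳ-≤ n (∣block∣≥m {n} j 3m≤n) ⟩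
      n ∸ m                           ∎
    where open ≤-Reasoning

  ¬good : n ≤ m + m + m → ∀ H → ¬ Good extremalColouring 2 (suc m) H
  ¬good n≤3m H good@(conn , _) =
    let c , c∉H = missing-colour good (s≤s ≤-refl)
        j , within = within-two-blocks part H c∉H conn (∣block∣≤m {n} c) (partition≢3F n≤3m)
    in ¬within-two-blocks part H c∉H conn (∣block∣≤m {n} j) within

  Ism-≡0 : n ≤ m + m + m → ∀ {v} → Ism n 3 2 (suc m) v → v ≡ 0
  Ism-≡0 n≤3m (_ , minimal) = n≤0⇒n≡0 (minimal extremalColouring 0 (IsM-none (¬good n≤3m)))

  Ism-≤n∸m : m + m + m ≤ n → ∀ {v} → Ism n 3 2 (suc m) v → v ≤ n ∸ m
  Ism-≤n∸m 3m≤n (_ , minimal) =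
    let w , isM = M-exists extremalColouring 2 (suc m)
    in ≤-trans (minimal extremalColouring w isM) (IsM-≤ (good⇒∣V∣≤n∸m 3m≤n) isM)

3*[1+m]≡3+3m : ∀ m → 3 * suc m ≡ 3 + (m + m + m)
3*[1+m]≡3+3m = solve 1 (λ m → con 3 :* (con 1 :+ m) := con 3 :+ (m :+ m :+ m)) refl
  where open +-*-Solver

n+3≤3[1+m]⇒n≤3m : ∀ n m → n + 3 ≤ 3 * suc m → n ≤ m + m + m
n+3≤3[1+m]⇒n≤3m n m n+3≤ = +-cancelˡ-≤ 3 n _ (subst₂ _≤_ (+-comm n 3) (3*[1+m]≡3+3m m) n+3≤)

3[1+m]≤n+2⇒3m≤n : ∀ n m → 3 * suc m ≤ n + 2 → m + m + m ≤ n
3[1+m]≤n+2⇒3m≤n n m ≤n+2 = <⇒≤ (+-cancelˡ-≤ 2 _ n (subst₂ _≤_ (3*[1+m]≡3+3m m) (+-comm n 2) ≤n+2))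

v≤n∸m⇒v+[1+m]≤n+1 : ∀ {v n} m → m + m + m ≤ n → v ≤ n ∸ m → v + suc m ≤ n + 1
v≤n∸m⇒v+[1+m]≤n+1 {v} {n} m 3m≤n v≤n∸m = begin
  v + suc m       ≡⟨ +-suc v m ⟩
  suc (v + m)     ≤⟨ s≤s (+-monoˡ-≤ m v≤n∸m) ⟩
  suc (n ∸ m + m) ≡⟨ cong suc (m∸n+n≡m (≤-trans (m≤m+n m m) (≤-trans (m≤m+n (m + m) m) 3m≤n))) ⟩
  suc n           ≡⟨ +-comm 1 n ⟩
  n + 1           ∎
  where open ≤-Reasoning

lemma3p5 : (n k : ℕ) → 2 ≤ n →
           ((n + 3 ≤ 3 * k) → Σ[ v ∈ ℕ ] (Ism n 3 2 k v × v ≡ 0)) ×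
           ((3 * k ≤ n + 2) → Σ[ v ∈ ℕ ] (Ism n 3 2 k v × v + k ≤ n + 1))
lemma3p5 n zero _ =
  (λ n+3≤0 → ⊥-elim (m+1+n≢0 n (n≤0⇒n≡0 n+3≤0))) ,
  (λ _ → let v , ism = m-exists n 2 2 0
         in v , ism , ≤-trans (≤-reflexive (+-identityʳ v)) (≤-trans (Ism-≤n ism) (m≤m+n n 1)))
lemma3p5 n (suc m) _ =
  (λ n+3≤3k → v , ism , Ism-≡0 m (n+3≤3[1+m]⇒n≤3m n m n+3≤3k) ism) ,
  (λ 3k≤n+2 → let 3m≤n = 3[1+m]≤n+2⇒3m≤n n m 3k≤n+2
              in v , ism , v≤n∸m⇒v+[1+m]≤n+1 m 3m≤n (Ism-≤n∸m m 3m≤n ism))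
  where
  v : ℕ
  v = proj₁ (m-exists n 2 2 (suc m))
  ism : Ism n 3 2 (suc m) v
  ism = proj₂ (m-exists n 2 2 (suc m))
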